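{- Let $G$ be a graph, let $Q$ be a clique of $G$ with $q\ge 2$ vertices, and let $G'$ be the graph obtained from $G$ by adding a new vertex $v$ adjacent to exactly the vertices of $Q$. There exists an acyclic orientation $D$ of $G$ with $d(D)=d_{\min}(G)$ such that $Q$ contains a dependent arc that is non-trivial with respect to $D$ if and only if $d_{\min}(G')=d_{\min}(G)+q-2$.
   Context: All graphs are finite, without loops or multiple edges. A clique is a set of pairwise adjacent vertices. An orientation assigns a direction to each edge; it is acyclic if it contains no directed cycle. In an acyclic orientation $D$, an arc is called dependent if reversing it creates a directed cycle; $d(D)$ is the number of dependent arcs of $D$, and $d_{\min}(G)$ is the minimum of $d(D)$ over all acyclic orientations $D$ of $G$. An arc of $D$ with both endpoints in $Q$ is called non-trivial with respect to $D$ if it is dependent in $D$ but not dependent in the orientation $D[Q]$ induced by $D$ on the subgraph induced by $Q$. -}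

module Defs where

open import Data.Nat using (ℕ; zero; suc; _≤_)
open import Data.Bool using (Bool; true; false; _∧_; if_then_else_)
open import Data.Fin using (Fin; zero; suc; _≟_)
open import Data.Fin.Subset using (Subset; _∈_; ∣_∣)
open import Data.Vec using (lookup)
open import Data.Product using (Σ; _×_; _,_; ∃)
open import Data.Sum using (_⊎_)
open import Data.Empty using (⊥)
open import Data.List using (List; length)
open import Data.List.Membership.Propositional using () renaming (_∈_ to _∈ₗ_)
open import Data.List.Relation.Unary.Unique.Propositional using (Unique)
open import Relation.Nullary using (¬_)
open import Relation.Nullary.Decidable using (⌊_⌋)
open import Relation.Binary.PropositionalEquality using (_≡_; _≢_; refl)
open import Function.Bundles using (_⇔_)

record Graph (n : ℕ) : Set where
  field
    adj   : Fin n → Fin n → Bool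
    adjSym : ∀ i j → adj i j ≡ adj j i
    irrfl : ∀ i → adj i i ≡ false
open Graph public

Rel : ℕ → Set
Rel n = Fin n → Fin n → Bool

data Walk⁺ {n : ℕ} (A : Rel n) : Fin n → Fin n → Set where
  arc  : ∀ {i j} → A i j ≡ true → Walk⁺ A i j
  step : ∀ {i j k} → A i j ≡ true → Walk⁺ A j k → Walk⁺ A i k

Acyclic : ∀ {n} → Rel n → Set
Acyclic {n} A = (i : Fin n) → ¬ Walk⁺ A i i

record Orientation {n : ℕ} (G : Graph n) : Set where
  field
    arcs     : Rel n
    on-edges : ∀ i j → arcs i j ≡ true → adj G i j ≡ true
    covers   : ∀ i j → adj G i j ≡ true → arcs i j ≡ true ⊎ arcs j i ≡ true
    one-way  : ∀ i j → arcs i j ≡ true → arcs j i ≡ false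
open Orientation public

AcyclicOrientation : ∀ {n} → Graph n → Set
AcyclicOrientation G = Σ (Orientation G) (λ D → Acyclic (arcs D))

reverseArc : ∀ {n} → Rel n → Fin n → Fin n → Rel n
reverseArc A a b x y =
  if ⌊ x ≟ b ⌋ ∧ ⌊ y ≟ a ⌋ then true
  else if ⌊ x ≟ a ⌋ ∧ ⌊ y ≟ b ⌋ then false
  else A x y

Dependent : ∀ {n} → Rel n → Fin n → Fin n → Set
Dependent A a b = (A a b ≡ true) × ¬ Acyclic (reverseArc A a b)

NumDependent : ∀ {n} → Rel n → ℕ → Set
NumDependent {n} A k =
  Σ (List (Fin n × Fin n)) λ L →
    Unique L × length L ≡ k ×
    (∀ a b → ((a , b) ∈ₗ L) ⇔ Dependent A a b)

IsDmin : ∀ {n} → Graph n → ℕ → Set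
IsDmin G m =
  (Σ (AcyclicOrientation G) λ D → NumDependent (arcs (Data.Product.proj₁ D)) m) ×
  (∀ (D : AcyclicOrientation G) k → NumDependent (arcs (Data.Product.proj₁ D)) k → m ≤ k)

IsClique : ∀ {n} → Graph n → Subset n → Set
IsClique G Q = ∀ i j → i ∈ Q → j ∈ Q → i ≢ j → adj G i j ≡ true

-- The orientation D[Q] induced on the subgraph induced by Q
-- (arcs of D with both endpoints in Q; vertices outside Q become isolated,
-- which does not affect directed cycles).
induced : ∀ {n} → Rel n → Subset n → Rel n
induced A Q x y = A x y ∧ lookup Q x ∧ lookup Q y

NonTrivial : ∀ {n} → Rel n → Subset n → Fin n → Fin n → Set
NonTrivial A Q a b = Dependent A a b × ¬ Dependent (induced A Q) a b

-- G' : add a new vertex (index zero) adjacent exactly to the vertices of Q;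
-- old vertex i becomes suc i.

extAdj : ∀ {n} → Graph n → Subset n → Rel (suc n)
extAdj G Q zero    zero    = false
extAdj G Q zero    (suc j) = lookup Q j
extAdj G Q (suc i) zero    = lookup Q i
extAdj G Q (suc i) (suc j) = adj G i j

extSym : ∀ {n} (G : Graph n) (Q : Subset n) i j → extAdj G Q i j ≡ extAdj G Q j i
extSym G Q zero    zero    = refl
extSym G Q zero    (suc j) = refl
extSym G Q (suc i) zero    = refl
extSym G Q (suc i) (suc j) = adjSym G i j

extIrr : ∀ {n} (G : Graph n) (Q : Subset n) i → extAdj G Q i i ≡ false
extIrr G Q zero    = refl
extIrr G Q (suc i) = irrfl G i

addVertex : ∀ {n} → Graph n → Subset n → Graph (suc n)
addVertex G Q = record { adj = extAdj G Q ; adjSym = extSym G Q ; irrfl = extIrr G Q }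

-- An arc a → b of an acyclic orientation is dependent exactly when there is a detour
-- a → c ⇝ b. Let v be the new vertex and D′ an acyclic orientation of G′ restricting to D on G.
-- As Q is a clique, every in-neighbour of v points to every out-neighbour of v; so walks of D′
-- project to walks of D, every dependent arc of D stays dependent in D′, and among the q arcs
-- between v and Q at most one entering and one leaving v are independent (of two independent
-- arcs x → v, x′ → v, the arc between x and x′ would give one of them a detour). Hence
-- d(D′) ≥ d(D) + q − 2 ≥ d_min(G) + q − 2. In the case of equality D is optimal, both
-- exceptional arcs x → v and v → y exist, and x → y, which is dependent in D′ via v, must
-- already be dependent in D (otherwise it would count once more). It is non-trivial: a detour
-- inside Q passes through a neighbour of v and would give an exceptional arc a detour. Conversely, from an optimal D with a non-trivial arc a → b
-- in Q, let a and its in-neighbours in Q point to v and v point to the rest of Q: no new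
-- dependent arcs arise among the old vertices, and a → v and v → b are independent, so
-- d_min(G′) ≤ d_min(G) + q − 2.

module Submission where

open import Defs
open import Data.Bool using (Bool; true; false; _∧_; _∨_; not; if_then_else_)
open import Data.Bool.Properties using (∧-zeroʳ; ∧-identityʳ; ∨-zeroʳ) renaming (_≟_ to _≟ᵇ_)
open import Data.Empty using (⊥; ⊥-elim)
import Data.Fin as Fin
open import Data.Fin using (Fin; zero; suc; _≟_)
open import Data.Fin.Properties as Finₚ using (any?; all?)
open import Data.Fin.Subset using (Subset; ∣_∣) renaming (_∈_ to _∈ˢ_)
open import Data.List using (List; []; _∷_; _++_; length; map; filter; cartesianProductWith)
open import Data.List.Extrema.Nat using (argmin; argmin-all; f[argmin]≤f[xs])
open import Data.List.Membership.Propositional using (_∈_)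
open import Data.List.Membership.Propositional.Properties
  using (∈-map⁺; ∈-map⁻; ∈-++⁺ˡ; ∈-++⁺ʳ; ∈-++⁻; ∈-filter⁺; ∈-cartesianProductWith⁺)
open import Data.List.Membership.Propositional.Properties.WithK using (unique∧set⇒bag)
open import Data.List.Properties using (length-map; length-++)
open import Data.List.Relation.Binary.BagAndSetEquality using (∼bag⇒↭)
open import Data.List.Relation.Binary.Permutation.Propositional.Properties using (↭-length)
import Data.List.Relation.Unary.All as All
open import Data.List.Relation.Unary.All.Properties using (all-filter)
open import Data.List.Relation.Unary.AllPairs using ([]; _∷_)
open import Data.List.Relation.Unary.Any using (here; there)
open import Data.List.Relation.Unary.Unique.Propositional using (Unique)
import Data.List.Relation.Unary.Unique.Propositional.Properties as Unique
open import Data.Nat using (ℕ; zero; suc; _+_; _∸_; _≤_; _<_; z≤n; s≤s)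
import Data.Nat.Properties as ℕ
open import Algebra.Properties.CommutativeSemigroup ℕ.+-commutativeSemigroup using (interchange)
open import Data.Nat.Tactic.RingSolver using (solve-∀)
open import Data.Product using (Σ; ∃; _×_; _,_; proj₁; proj₂)
import Data.Product as Product
open import Data.Sum using (_⊎_; inj₁; inj₂)
import Data.Sum as Sum
open import Data.Vec using ([]; _∷_; lookup)
open import Data.Vec.Functional using () renaming ([] to []ᶠ; _∷_ to _∷ᶠ_)
open import Data.Vec.Properties using (lookup⇒[]=; []=⇒lookup)
open import Function using (_∘_; id)
open import Function.Bundles using (_⇔_; mk⇔; Equivalence)
import Function.Properties.Equivalence as ⇔
open import Relation.Binary using (tri<; tri≈; tri>)
open import Relation.Binary.PropositionalEquality
  using (_≡_; _≢_; refl; sym; trans; cong; cong₂; subst; module ≡-Reasoning)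
open import Relation.Nullary using (¬_; Dec; yes; no)
open import Relation.Nullary.Decidable using (⌊_⌋; map′; ¬?; _⊎-dec_; _×-dec_; _→-dec_)

∧-trueˡ : ∀ {a b} → a ∧ b ≡ true → a ≡ true
∧-trueˡ {true} _ = refl

∧-trueʳ : ∀ {a b} → a ∧ b ≡ true → b ≡ true
∧-trueʳ {true} b≡true = b≡true

∧-true : ∀ {a b} → a ≡ true → b ≡ true → a ∧ b ≡ true
∧-true refl refl = refl

not-true : ∀ {a} → not a ≡ true → a ≡ false
not-true {false} _ = refl

true≢false : true ≢ false
true≢false ()

toWitness≡ : ∀ {P : Set} (d : Dec P) → ⌊ d ⌋ ≡ true → P
toWitness≡ (yes p) _ = p

fromWitness≡ : ∀ {P : Set} (d : Dec P) → P → ⌊ d ⌋ ≡ true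
fromWitness≡ (yes _) _  = refl
fromWitness≡ (no ¬p) p = ⊥-elim (¬p p)

toWitnessFalse≡ : ∀ {P : Set} (d : Dec P) → ⌊ d ⌋ ≡ false → ¬ P
toWitnessFalse≡ (no ¬p) _ = ¬p

fromWitnessFalse≡ : ∀ {P : Set} (d : Dec P) → ¬ P → ⌊ d ⌋ ≡ false
fromWitnessFalse≡ (yes p) ¬p = ⊥-elim (¬p p)
fromWitnessFalse≡ (no _)  _  = refl

infix 4 _⊆ᵇ_
_⊆ᵇ_ : ∀ {n} → (Fin n → Bool) → (Fin n → Bool) → Set
p ⊆ᵇ q = ∀ i → p i ≡ true → q i ≡ true

bit : Bool → ℕ
bit true  = 1
bit false = 0

count : ∀ {n} → (Fin n → Bool) → ℕ
count {zero}  p = 0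
count {suc n} p = bit (p zero) + count (p ∘ suc)

count-∅ : ∀ {n} {p : Fin n → Bool} → (∀ i → p i ≡ false) → count p ≡ 0
count-∅ {zero}          _  = refl
count-∅ {suc n} {p} none rewrite none zero = count-∅ (none ∘ suc)

bit-mono : ∀ {a b} → (a ≡ true → b ≡ true) → bit a ≤ bit b
bit-mono {false} _   = z≤n
bit-mono {true}  a⇒b rewrite a⇒b refl = ℕ.≤-refl

count-mono : ∀ {n} {p q : Fin n → Bool} → p ⊆ᵇ q → count p ≤ count q
count-mono {zero}  p⊆q = z≤n
count-mono {suc n} p⊆q = ℕ.+-mono-≤ (bit-mono (p⊆q zero)) (count-mono (p⊆q ∘ suc))

bit≤1 : ∀ b → bit b ≤ 1
bit≤1 true  = ℕ.≤-refl
bit≤1 false = z≤n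

count≤n : ∀ {n} (p : Fin n → Bool) → count p ≤ n
count≤n {zero}  p = z≤n
count≤n {suc n} p = ℕ.+-mono-≤ (bit≤1 (p zero)) (count≤n (p ∘ suc))

count-mono-< : ∀ {n} {p q : Fin n → Bool} {k} → p ⊆ᵇ q → q k ≡ true → p k ≡ false →
  count p < count q
count-mono-< {suc n} {k = zero} p⊆q qk pk rewrite qk | pk = s≤s (count-mono (p⊆q ∘ suc))
count-mono-< {suc n} {k = suc k} p⊆q qk pk =
  ℕ.+-mono-≤-< (bit-mono (p⊆q zero)) (count-mono-< (p⊆q ∘ suc) qk pk)

bit-split : ∀ a r → bit a ≡ bit (a ∧ r) + bit (a ∧ not r)
bit-split false _     = refl
bit-split true  false = refl
bit-split true  true  = refl

count-split : ∀ {n} (p r : Fin n → Bool) →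
  count p ≡ count (λ i → p i ∧ r i) + count (λ i → p i ∧ not (r i))
count-split {zero}  p r = refl
count-split {suc n} p r =
  trans (cong₂ _+_ (bit-split (p zero) (r zero)) (count-split (p ∘ suc) (r ∘ suc)))
        (interchange (bit (p zero ∧ r zero)) (bit (p zero ∧ not (r zero))) _ _)

count-cover : ∀ {n} {p q r : Fin n → Bool} → (∀ i → r i ≡ true → p i ≡ true ⊎ q i ≡ true) →
  count r ≤ count p + count q
count-cover {p = p} {q} {r} cover = begin
  count r                                                        ≡⟨ count-split r p ⟩
  count (λ i → r i ∧ p i) + count (λ i → r i ∧ not (p i))       ≤⟨ ℕ.+-mono-≤ (count-mono inP) (count-mono inQ) ⟩
  count p + count q                                              ∎
  where
  open ℕ.≤-Reasoning
  inP : (λ i → r i ∧ p i) ⊆ᵇ p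
  inP i = ∧-trueʳ {r i}
  inQ : (λ i → r i ∧ not (p i)) ⊆ᵇ q
  inQ i ri∧¬pi with cover i (∧-trueˡ ri∧¬pi)
  ... | inj₁ pi = ⊥-elim (true≢false (trans (sym pi) (not-true (∧-trueʳ {r i} ri∧¬pi))))
  ... | inj₂ qi = qi

count-≤-+-slack : ∀ {n} (p q : Fin n → Bool) → count p ≤ count q + count (λ i → p i ∧ not (q i))
count-≤-+-slack p q =
  ℕ.≤-trans (ℕ.≤-reflexive (count-split p q)) (ℕ.+-monoˡ-≤ _ (count-mono λ i → ∧-trueʳ {p i}))

count-≤1 : ∀ {n} {p : Fin n → Bool} → (∀ i j → p i ≡ true → p j ≡ true → i ≡ j) → count p ≤ 1
count-≤1 {zero}          _   = z≤n
count-≤1 {suc n} {p} unique with p zero in p0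
... | true  = s≤s (ℕ.≤-reflexive (count-∅ none))
  where
  none : ∀ i → p (suc i) ≡ false
  none i with p (suc i) in pi
  ... | false = refl
  ... | true  with () ← unique zero (suc i) p0 pi
... | false = count-≤1 (λ i j pi pj → Finₚ.suc-injective (unique (suc i) (suc j) pi pj))

count-∅-or-witness : ∀ {n} (p : Fin n → Bool) → count p ≡ 0 ⊎ ∃ λ i → p i ≡ true
count-∅-or-witness {zero}  p = inj₁ refl
count-∅-or-witness {suc n} p with p zero in p0
... | true  = inj₂ (zero , p0)
... | false = Sum.map id (λ (i , pi) → suc i , pi) (count-∅-or-witness (p ∘ suc))

∣∣≡count-lookup : ∀ {n} (Q : Subset n) → ∣ Q ∣ ≡ count (lookup Q)
∣∣≡count-lookup []          = refl
∣∣≡count-lookup (true ∷ Q)  = cong suc (∣∣≡count-lookup Q)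
∣∣≡count-lookup (false ∷ Q) = ∣∣≡count-lookup Q

infix 4 _⊆ᴿ_
_⊆ᴿ_ : ∀ {n} → Rel n → Rel n → Set
A ⊆ᴿ B = ∀ i j → A i j ≡ true → B i j ≡ true

module _ {n : ℕ} where

  Walk⁺-mono : {A B : Rel n} → A ⊆ᴿ B → ∀ {i j} → Walk⁺ A i j → Walk⁺ B i j
  Walk⁺-mono A⊆B (arc a)    = arc (A⊆B _ _ a)
  Walk⁺-mono A⊆B (step a w) = step (A⊆B _ _ a) (Walk⁺-mono A⊆B w)

  Acyclic-antimono : {A B : Rel n} → A ⊆ᴿ B → Acyclic B → Acyclic A
  Acyclic-antimono A⊆B acyclic i = acyclic i ∘ Walk⁺-mono A⊆B

  infixr 5 _⁺++⁺_ _*++⁺_ _⁺++*_ _*++*_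

  _⁺++⁺_ : {A : Rel n} → ∀ {i j k} → Walk⁺ A i j → Walk⁺ A j k → Walk⁺ A i k
  arc a    ⁺++⁺ w = step a w
  step a v ⁺++⁺ w = step a (v ⁺++⁺ w)

  Walk* : Rel n → Fin n → Fin n → Set
  Walk* A i j = i ≡ j ⊎ Walk⁺ A i j

  _*++⁺_ : {A : Rel n} → ∀ {i j k} → Walk* A i j → Walk⁺ A j k → Walk⁺ A i k
  inj₁ refl *++⁺ w = w
  inj₂ v    *++⁺ w = v ⁺++⁺ w

  _⁺++*_ : {A : Rel n} → ∀ {i j k} → Walk⁺ A i j → Walk* A j k → Walk⁺ A i k
  v ⁺++* inj₁ refl = v
  v ⁺++* inj₂ w    = v ⁺++⁺ w

  _*++*_ : {A : Rel n} → ∀ {i j k} → Walk* A i j → Walk* A j k → Walk* A i k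
  inj₁ refl *++* w = w
  inj₂ v    *++* w = inj₂ (v ⁺++* w)

  _↾_ : Rel n → (Fin n → Bool) → Rel n
  (A ↾ X) x y = A x y ∧ X y

  _─_ : (Fin n → Bool) → Fin n → Fin n → Bool
  (X ─ k) y = X y ∧ not ⌊ y ≟ k ⌋

  ─-⊆ : ∀ X k → (X ─ k) ⊆ᵇ X
  ─-⊆ X k y = ∧-trueˡ

  ─-keeps : ∀ X {k y} → y ≢ k → X y ≡ true → (X ─ k) y ≡ true
  ─-keeps X {k} {y} y≢k Xy with y ≟ k
  ... | yes y≡k = ⊥-elim (y≢k y≡k)
  ... | no  _   = ∧-true Xy refl

  ─-removes : ∀ X k → (X ─ k) k ≡ false
  ─-removes X k with k ≟ k
  ... | yes _  = ∧-zeroʳ (X k)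
  ... | no k≢k = ⊥-elim (k≢k refl)

  ↾-─ : ∀ A X {k x y} → (A ↾ X) x y ≡ true → y ≢ k → (A ↾ (X ─ k)) x y ≡ true
  ↾-─ A X {x = x} {y} a y≢k = ∧-true (∧-trueˡ {A x y} a) (─-keeps X y≢k (∧-trueʳ {A x y} a))

  ↾-─-⊆ : ∀ A X k → A ↾ (X ─ k) ⊆ᴿ A ↾ X
  ↾-─-⊆ A X k x y a = ∧-true (∧-trueˡ {A x y} a) (─-⊆ X k y (∧-trueʳ {A x y} a))

  last-visit : ∀ A X k {x j} → Walk⁺ (A ↾ X) x j →
    j ≡ k ⊎ Walk⁺ (A ↾ (X ─ k)) x j ⊎ Walk⁺ (A ↾ (X ─ k)) k j
  last-visit A X k {j = j} (arc a) with j ≟ k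
  ... | yes j≡k = inj₁ j≡k
  ... | no  j≢k = inj₂ (inj₁ (arc (↾-─ A X a j≢k)))
  last-visit A X k (step {j = m} a w) with last-visit A X k w | m ≟ k
  ... | inj₁ j≡k         | _        = inj₁ j≡k
  ... | inj₂ (inj₂ w′)   | _        = inj₂ (inj₂ w′)
  ... | inj₂ (inj₁ w′)   | yes refl = inj₂ (inj₂ w′)
  ... | inj₂ (inj₁ w′)   | no m≢k   = inj₂ (inj₁ (step (↾-─ A X a m≢k) w′))

  -- Induction on the number of admissible heads: after the first step to k, the rest of the
  -- walk can be cut at its last visit to k, so k is no longer needed as a head.
  Walk⁺-↾-dec : ∀ fuel A X → count X < fuel → ∀ i j → Dec (Walk⁺ (A ↾ X) i j)
  Walk⁺-↾-dec (suc fuel) A X count<fuel i j = map′ join split (any? first-step?)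
    where
    FirstStep : Fin n → Set
    FirstStep k = (A ↾ X) i k ≡ true × (k ≡ j ⊎ Walk⁺ (A ↾ (X ─ k)) k j)

    first-step? : ∀ k → Dec (FirstStep k)
    first-step? k with (A ↾ X) i k in a
    ... | false = no λ ()
    ... | true  = map′ (refl ,_) proj₂ ((k ≟ j) ⊎-dec Walk⁺-↾-dec fuel A (X ─ k) smaller k j)
      where
      smaller : count (X ─ k) < fuel
      smaller = ℕ.<-≤-trans (count-mono-< (─-⊆ X k) (∧-trueʳ {A i k} a) (─-removes X k))
                            (ℕ.≤-pred count<fuel)

    join : Σ (Fin n) FirstStep → Walk⁺ (A ↾ X) i j
    join (k , a , inj₁ refl) = arc a
    join (k , a , inj₂ w)    = step a (Walk⁺-mono (↾-─-⊆ A X k) w)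

    split : Walk⁺ (A ↾ X) i j → Σ (Fin n) FirstStep
    split (arc a) = j , a , inj₁ refl
    split (step {j = k} a w) with last-visit A X k w
    ... | inj₁ j≡k        = k , a , inj₁ (sym j≡k)
    ... | inj₂ (inj₁ w′)  = k , a , inj₂ w′
    ... | inj₂ (inj₂ w′)  = k , a , inj₂ w′

Walk⁺-dec : ∀ {n} (A : Rel n) i j → Dec (Walk⁺ A i j)
Walk⁺-dec {n} A i j =
  map′ (Walk⁺-mono (λ _ _ → ∧-trueˡ)) (Walk⁺-mono (λ _ _ a → ∧-true a refl))
       (Walk⁺-↾-dec (suc n) A (λ _ → true) (s≤s (count≤n _)) i j)

Acyclic-dec : ∀ {n} (A : Rel n) → Dec (Acyclic A)
Acyclic-dec A = all? (λ i → ¬? (Walk⁺-dec A i i))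

Dependent-dec : ∀ {n} (A : Rel n) a b → Dec (Dependent A a b)
Dependent-dec A a b = (A a b ≟ᵇ true) ×-dec ¬? (Acyclic-dec (reverseArc A a b))

-- Dependent arcs are the arcs with a detour

Detour : ∀ {n} → Rel n → Fin n → Fin n → Set
Detour {n} A a b = Σ (Fin n) λ c → A a c ≡ true × Walk⁺ A c b

Detour-dec : ∀ {n} (A : Rel n) a b → Dec (Detour A a b)
Detour-dec A a b = any? λ c → (A a c ≟ᵇ true) ×-dec Walk⁺-dec A c b

deleteArc : ∀ {n} → Rel n → Fin n → Fin n → Rel n
deleteArc A a b x y = A x y ∧ not (⌊ x ≟ a ⌋ ∧ ⌊ y ≟ b ⌋)

if-false≡∧not : ∀ c t → (if c then false else t) ≡ t ∧ not c
if-false≡∧not true  t = sym (∧-zeroʳ t)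
if-false≡∧not false t = sym (∧-identityʳ t)

module _ {n : ℕ} (A : Rel n) (a b : Fin n) where

  reverseArc-cases : ∀ x y → (x ≡ b × y ≡ a) ⊎ reverseArc A a b x y ≡ deleteArc A a b x y
  reverseArc-cases x y with x ≟ b | y ≟ a
  ... | yes refl | yes refl = inj₁ (refl , refl)
  ... | yes _    | no _     = inj₂ (if-false≡∧not (⌊ x ≟ a ⌋ ∧ ⌊ y ≟ b ⌋) (A x y))
  ... | no _     | _        = inj₂ (if-false≡∧not (⌊ x ≟ a ⌋ ∧ ⌊ y ≟ b ⌋) (A x y))

  reverseArc-reversed : reverseArc A a b b a ≡ true
  reverseArc-reversed with b ≟ b | a ≟ a
  ... | yes _  | yes _  = refl
  ... | no b≢b | _      = ⊥-elim (b≢b refl)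
  ... | yes _  | no a≢a = ⊥-elim (a≢a refl)

  deleteArc⊆reverseArc : deleteArc A a b ⊆ᴿ reverseArc A a b
  deleteArc⊆reverseArc x y d with reverseArc-cases x y
  ... | inj₁ (refl , refl) = reverseArc-reversed
  ... | inj₂ r≡d           = trans r≡d d

  deleteArc⊆ : deleteArc A a b ⊆ᴿ A
  deleteArc⊆ x y = ∧-trueˡ

  deleteArc-removes : deleteArc A a b a b ≡ false
  deleteArc-removes with a ≟ a | b ≟ b
  ... | yes _  | yes _  = ∧-zeroʳ (A a b)
  ... | no a≢a | _      = ⊥-elim (a≢a refl)
  ... | yes _  | no b≢b = ⊥-elim (b≢b refl)

  deleteArc-keeps : ∀ {x y} → A x y ≡ true → ¬ (x ≡ a × y ≡ b) → deleteArc A a b x y ≡ true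
  deleteArc-keeps {x} {y} xy ¬ab with x ≟ a | y ≟ b
  ... | yes x≡a | yes y≡b = ⊥-elim (¬ab (x≡a , y≡b))
  ... | yes _   | no _    = ∧-true xy refl
  ... | no _    | _       = ∧-true xy refl

  private
    A⁻ : Rel n
    A⁻ = deleteArc A a b

  walk-in-reverseArc : ∀ {x y} → Walk⁺ (reverseArc A a b) x y →
    Walk⁺ A⁻ x y ⊎ (Walk* A⁻ x b × Walk* A⁻ a y)
  walk-in-reverseArc {x} {y} (arc r) with reverseArc-cases x y
  ... | inj₁ (refl , refl) = inj₂ (inj₁ refl , inj₁ refl)
  ... | inj₂ r≡d           = inj₁ (arc (trans (sym r≡d) r))
  walk-in-reverseArc {x} (step {j = m} r w) with reverseArc-cases x m | walk-in-reverseArc w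
  ... | inj₁ (refl , refl) | inj₁ m→y          = inj₂ (inj₁ refl , inj₂ m→y)
  ... | inj₁ (refl , refl) | inj₂ (_ , a→y)    = inj₂ (inj₁ refl , a→y)
  ... | inj₂ r≡d           | inj₁ m→y          = inj₁ (step (trans (sym r≡d) r) m→y)
  ... | inj₂ r≡d           | inj₂ (m→b , a→y)  = inj₂ (inj₂ (arc (trans (sym r≡d) r) ⁺++* m→b) , a→y)

  walk-avoiding-arc : ∀ {u v} → Walk⁺ A u v → Walk⁺ A⁻ u v ⊎ Walk* A u a
  walk-avoiding-arc {u} {v} (arc uv) with u ≟ a | v ≟ b
  ... | yes u≡a | yes _   = inj₂ (inj₁ u≡a)
  ... | yes _   | no v≢b  = inj₁ (arc (deleteArc-keeps uv (v≢b ∘ proj₂)))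
  ... | no u≢a  | _       = inj₁ (arc (deleteArc-keeps uv (u≢a ∘ proj₁)))
  walk-avoiding-arc {u} (step um w) with u ≟ a
  ... | yes u≡a = inj₂ (inj₁ u≡a)
  ... | no u≢a with walk-avoiding-arc w
  ...   | inj₁ w⁻  = inj₁ (step (deleteArc-keeps um (u≢a ∘ proj₁)) w⁻)
  ...   | inj₂ m→a = inj₂ (inj₂ (arc um ⁺++* m→a))

  dependent⇒detour : Acyclic A → Dependent A a b → Detour A a b
  dependent⇒detour acyclic (ab , cyclic) with Detour-dec A a b
  ... | yes detour = detour
  ... | no ¬detour = ⊥-elim (cyclic acyclic-reversed)
    where
    acyclic-reversed : Acyclic (reverseArc A a b)
    acyclic-reversed i cycle with walk-in-reverseArc cycle
    ... | inj₁ w = acyclic i (Walk⁺-mono deleteArc⊆ w)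
    ... | inj₂ (i→b , a→i) with a→i *++* i→b
    ...   | inj₁ refl        = acyclic a (arc ab)
    ...   | inj₂ (arc ab⁻)   = true≢false (trans (sym ab⁻) deleteArc-removes)
    ...   | inj₂ (step ac w) = ¬detour (_ , deleteArc⊆ _ _ ac , Walk⁺-mono deleteArc⊆ w)

  detour⇒dependent : Acyclic A → A a b ≡ true → Detour A a b → Dependent A a b
  detour⇒dependent acyclic ab (c , ac , c→b) = ab , λ acyclic-reversed → acyclic-reversed b cycle
    where
    c≢b : c ≢ b
    c≢b refl = acyclic c c→b
    c→b⁻ : Walk⁺ A⁻ c b
    c→b⁻ with walk-avoiding-arc c→b
    ... | inj₁ w   = w
    ... | inj₂ c→a = ⊥-elim (acyclic a (arc ac ⁺++* c→a))
    cycle : Walk⁺ (reverseArc A a b) b b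
    cycle = step reverseArc-reversed
              (step (deleteArc⊆reverseArc a c (deleteArc-keeps ac (c≢b ∘ proj₂)))
                    (Walk⁺-mono deleteArc⊆reverseArc c→b⁻))

induced⊆ : ∀ {n} (A : Rel n) (Q : Subset n) → induced A Q ⊆ᴿ A
induced⊆ A Q i j = ∧-trueˡ

select : ∀ {n} → (Fin n → Bool) → List (Fin n)
select {zero}  p = []
select {suc n} p with p zero
... | true  = zero ∷ map suc (select (p ∘ suc))
... | false = map suc (select (p ∘ suc))

length-select : ∀ {n} (p : Fin n → Bool) → length (select p) ≡ count p
length-select {zero}  p = refl
length-select {suc n} p with p zero
... | true  = cong suc (trans (length-map (Fin.suc {n}) (select (p ∘ suc))) (length-select (p ∘ suc)))
... | false = trans (length-map (Fin.suc {n}) (select (p ∘ suc))) (length-select (p ∘ suc))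

∈-select⁻ : ∀ {n} (p : Fin n → Bool) {i} → i ∈ select p → p i ≡ true
∈-select⁻ {suc n} p i∈ with p zero in p0 | i∈
... | true  | here refl = p0
... | true  | there i∈′ with _ , j∈ , refl ← ∈-map⁻ suc i∈′ = ∈-select⁻ (p ∘ suc) j∈
... | false | i∈′       with _ , j∈ , refl ← ∈-map⁻ suc i∈′ = ∈-select⁻ (p ∘ suc) j∈

∈-select⁺ : ∀ {n} (p : Fin n → Bool) {i} → p i ≡ true → i ∈ select p
∈-select⁺ {suc n} p {i} pi with p zero in p0 | i
... | true  | zero  = here refl
... | true  | suc j = there (∈-map⁺ suc (∈-select⁺ (p ∘ suc) pi))
... | false | zero  = ⊥-elim (true≢false (trans (sym pi) p0))
... | false | suc j = ∈-map⁺ suc (∈-select⁺ (p ∘ suc) pi)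

select-unique : ∀ {n} (p : Fin n → Bool) → Unique (select p)
select-unique {zero}  p = []
select-unique {suc n} p with p zero
... | true  = All.tabulate zero∉ ∷ Unique.map⁺ Finₚ.suc-injective (select-unique (p ∘ suc))
  where
  zero∉ : ∀ {i} → i ∈ map suc (select (p ∘ suc)) → zero ≢ i
  zero∉ i∈ with _ , _ , refl ← ∈-map⁻ suc i∈ = λ ()
... | false = Unique.map⁺ Finₚ.suc-injective (select-unique (p ∘ suc))

infix 4 _⊆²_
_⊆²_ : ∀ {m n} → (Fin m → Fin n → Bool) → (Fin m → Fin n → Bool) → Set
p ⊆² q = ∀ i j → p i j ≡ true → q i j ≡ true

-- Row by row, so that for a relation on Fin (suc n) the arcs leaving vertex zero split off
-- definitionally.
count² : ∀ {m n} → (Fin m → Fin n → Bool) → ℕ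
count² {zero}  p = 0
count² {suc m} p = count (p zero) + count² (p ∘ suc)

count²-peel-column : ∀ {m n} (p : Fin m → Fin (suc n) → Bool) →
  count² p ≡ count (λ i → p i zero) + count² (λ i j → p i (suc j))
count²-peel-column {zero}  p = refl
count²-peel-column {suc m} p =
  trans (cong (count (p zero) +_) (count²-peel-column (p ∘ suc)))
        (interchange (bit (p zero zero)) (count (p zero ∘ suc)) _ _)

count²-mono : ∀ {m n} {p q : Fin m → Fin n → Bool} → p ⊆² q → count² p ≤ count² q
count²-mono {zero}  p⊆q = z≤n
count²-mono {suc m} p⊆q = ℕ.+-mono-≤ (count-mono (p⊆q zero)) (count²-mono (p⊆q ∘ suc))

count²-mono-< : ∀ {m n} {p q : Fin m → Fin n → Bool} {a b} → p ⊆² q →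
  q a b ≡ true → p a b ≡ false → count² p < count² q
count²-mono-< {suc m} {a = zero}  p⊆q qab pab =
  ℕ.+-mono-<-≤ (count-mono-< (p⊆q zero) qab pab) (count²-mono (p⊆q ∘ suc))
count²-mono-< {suc m} {a = suc a} p⊆q qab pab =
  ℕ.+-mono-≤-< (count-mono (p⊆q zero)) (count²-mono-< (p⊆q ∘ suc) qab pab)

select² : ∀ {m n} → (Fin m → Fin n → Bool) → List (Fin m × Fin n)
select² {zero}  p = []
select² {suc m} p = map (zero ,_) (select (p zero)) ++ map (Product.map₁ suc) (select² (p ∘ suc))

length-select² : ∀ {m n} (p : Fin m → Fin n → Bool) → length (select² p) ≡ count² p
length-select² {zero}  p = refl
length-select² {suc m} p = begin
  length (map (zero ,_) (select (p zero)) ++ map (Product.map₁ suc) (select² (p ∘ suc)))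
    ≡⟨ length-++ (map (zero ,_) (select (p zero))) ⟩
  length (map (zero ,_) (select (p zero))) + length (map (Product.map₁ suc) (select² (p ∘ suc)))
    ≡⟨ cong₂ _+_ (length-map (zero ,_) (select (p zero))) (length-map (Product.map₁ suc) (select² (p ∘ suc))) ⟩
  length (select (p zero)) + length (select² (p ∘ suc))
    ≡⟨ cong₂ _+_ (length-select (p zero)) (length-select² (p ∘ suc)) ⟩
  count (p zero) + count² (p ∘ suc) ∎
  where open ≡-Reasoning

∈-select²⁻ : ∀ {m n} (p : Fin m → Fin n → Bool) {a b} → (a , b) ∈ select² p → p a b ≡ true
∈-select²⁻ {suc m} p ab∈ with ∈-++⁻ (map (zero ,_) (select (p zero))) ab∈
... | inj₁ ab∈row  with _ , b∈ , refl ← ∈-map⁻ (zero ,_) ab∈row = ∈-select⁻ (p zero) b∈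
... | inj₂ ab∈rest with _ , ab∈′ , refl ← ∈-map⁻ (Product.map₁ suc) ab∈rest = ∈-select²⁻ (p ∘ suc) ab∈′

∈-select²⁺ : ∀ {m n} (p : Fin m → Fin n → Bool) {a b} → p a b ≡ true → (a , b) ∈ select² p
∈-select²⁺ {suc m} p {zero}  pab = ∈-++⁺ˡ (∈-map⁺ (zero ,_) (∈-select⁺ (p zero) pab))
∈-select²⁺ {suc m} p {suc a} pab =
  ∈-++⁺ʳ (map (zero ,_) (select (p zero))) (∈-map⁺ (Product.map₁ suc) (∈-select²⁺ (p ∘ suc) pab))

select²-unique : ∀ {m n} (p : Fin m → Fin n → Bool) → Unique (select² p)
select²-unique {zero}  p = []
select²-unique {suc m} p =
  Unique.++⁺ (Unique.map⁺ (cong proj₂) (select-unique (p zero)))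
             (Unique.map⁺ (λ { refl → refl }) (select²-unique (p ∘ suc)))
             different-rows
  where
  different-rows : ∀ {ab} → ¬ (ab ∈ map (zero ,_) (select (p zero)) × ab ∈ map (Product.map₁ suc) (select² (p ∘ suc)))
  different-rows (ab∈row , ab∈rest) with ∈-map⁻ (zero ,_) ab∈row | ∈-map⁻ (Product.map₁ suc) ab∈rest
  ... | _ , _ , refl | _ , _ , ()

dependent? : ∀ {n} → Rel n → Fin n → Fin n → Bool
dependent? A a b = ⌊ Dependent-dec A a b ⌋

numDependent : ∀ {n} → Rel n → ℕ
numDependent A = count² (dependent? A)

numDependent-correct : ∀ {n} (A : Rel n) → NumDependent A (numDependent A)
numDependent-correct A =
  select² (dependent? A) , select²-unique (dependent? A) , length-select² (dependent? A) ,
  λ a b → mk⇔ (toWitness≡ (Dependent-dec A a b) ∘ ∈-select²⁻ (dependent? A))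
              (∈-select²⁺ (dependent? A) ∘ fromWitness≡ (Dependent-dec A a b))

NumDependent-functional : ∀ {n} {A : Rel n} {k k′} → NumDependent A k → NumDependent A k′ → k ≡ k′
NumDependent-functional (L , L-unique , refl , ∈L⇔) (L′ , L′-unique , refl , ∈L′⇔) =
  ↭-length (∼bag⇒↭ (unique∧set⇒bag L-unique L′-unique λ {(a , b)} → ⇔.trans (∈L⇔ a b) (⇔.sym (∈L′⇔ a b))))

numDependent-unique : ∀ {n} {A : Rel n} {k} → NumDependent A k → numDependent A ≡ k
numDependent-unique = NumDependent-functional (numDependent-correct _)

-- Existence of d_min

-- d_min is an argmin over an explicit enumeration of all relations. The enumeration contains a
-- given relation only up to pointwise equality (there is no function extensionality), so the
-- notions involved are shown to respect ≗ᴿ.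
infix 4 _≗ᴿ_
_≗ᴿ_ : ∀ {n} → Rel n → Rel n → Set
A ≗ᴿ B = ∀ i j → A i j ≡ B i j

module _ {n : ℕ} {A B : Rel n} (A≗B : A ≗ᴿ B) where

  ≗ᴿ⇒⊆ᴿ : A ⊆ᴿ B
  ≗ᴿ⇒⊆ᴿ i j = trans (sym (A≗B i j))

  ≗ᴿ⇒⊇ᴿ : B ⊆ᴿ A
  ≗ᴿ⇒⊇ᴿ i j = trans (A≗B i j)

  Acyclic-resp : Acyclic A → Acyclic B
  Acyclic-resp = Acyclic-antimono ≗ᴿ⇒⊇ᴿ

  reverseArc-resp : ∀ a b → reverseArc A a b ≗ᴿ reverseArc B a b
  reverseArc-resp a b x y =
    cong (λ t → if ⌊ x ≟ b ⌋ ∧ ⌊ y ≟ a ⌋ then true else if ⌊ x ≟ a ⌋ ∧ ⌊ y ≟ b ⌋ then false else t)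
         (A≗B x y)

  Dependent-resp : ∀ {a b} → Dependent A a b → Dependent B a b
  Dependent-resp {a} {b} (ab , cyclic) =
    ≗ᴿ⇒⊆ᴿ a b ab , cyclic ∘ Acyclic-antimono reversed-⊆
    where
    reversed-⊆ : reverseArc A a b ⊆ᴿ reverseArc B a b
    reversed-⊆ i j = trans (sym (reverseArc-resp a b i j))

≗ᴿ-sym : ∀ {n} {A B : Rel n} → A ≗ᴿ B → B ≗ᴿ A
≗ᴿ-sym A≗B i j = sym (A≗B i j)

NumDependent-resp : ∀ {n} {A B : Rel n} {k} → A ≗ᴿ B → NumDependent A k → NumDependent B k
NumDependent-resp A≗B (L , L-unique , length≡k , ∈L⇔) = L , L-unique , length≡k , λ a b →
  mk⇔ (Dependent-resp A≗B ∘ Equivalence.to (∈L⇔ a b))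
      (Equivalence.from (∈L⇔ a b) ∘ Dependent-resp (≗ᴿ-sym A≗B))

IsAcyclicOrientation : ∀ {n} → Graph n → Rel n → Set
IsAcyclicOrientation G B =
  (∀ i j → B i j ≡ true → adj G i j ≡ true) ×
  (∀ i j → adj G i j ≡ true → B i j ≡ true ⊎ B j i ≡ true) ×
  (∀ i j → B i j ≡ true → B j i ≡ false) ×
  Acyclic B

module _ {n : ℕ} (G : Graph n) where

  IsAcyclicOrientation-dec : ∀ B → Dec (IsAcyclicOrientation G B)
  IsAcyclicOrientation-dec B =
    all? (λ i → all? λ j → (B i j ≟ᵇ true) →-dec (adj G i j ≟ᵇ true)) ×-dec
    all? (λ i → all? λ j → (adj G i j ≟ᵇ true) →-dec ((B i j ≟ᵇ true) ⊎-dec (B j i ≟ᵇ true))) ×-dec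
    all? (λ i → all? λ j → (B i j ≟ᵇ true) →-dec (B j i ≟ᵇ false)) ×-dec
    Acyclic-dec B

  isAcyclicOrientation : (D : AcyclicOrientation G) → IsAcyclicOrientation G (arcs (proj₁ D))
  isAcyclicOrientation (D , acyclic) = on-edges D , covers D , one-way D , acyclic

  toAcyclicOrientation : ∀ {B} → IsAcyclicOrientation G B → AcyclicOrientation G
  toAcyclicOrientation {B} (on-edges , covers , one-way , acyclic) =
    record { arcs = B ; on-edges = on-edges ; covers = covers ; one-way = one-way } , acyclic

  IsAcyclicOrientation-resp : ∀ {A B} → A ≗ᴿ B → IsAcyclicOrientation G A → IsAcyclicOrientation G B
  IsAcyclicOrientation-resp A≗B (on-edges , covers , one-way , acyclic) =
    (λ i j → on-edges i j ∘ ≗ᴿ⇒⊇ᴿ A≗B i j) ,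
    (λ i j → Sum.map (≗ᴿ⇒⊆ᴿ A≗B i j) (≗ᴿ⇒⊆ᴿ A≗B j i) ∘ covers i j) ,
    (λ i j → trans (sym (A≗B j i)) ∘ one-way i j ∘ ≗ᴿ⇒⊇ᴿ A≗B i j) ,
    Acyclic-resp A≗B acyclic

  indexOrder : AcyclicOrientation G
  indexOrder = toAcyclicOrientation (B-on-edges , B-covers , B-one-way , B-acyclic)
    where
    B : Rel n
    B i j = adj G i j ∧ ⌊ i Fin.<? j ⌋
    B⇒< : ∀ {i j} → B i j ≡ true → i Fin.< j
    B⇒< {i} {j} ij = toWitness≡ (i Fin.<? j) (∧-trueʳ {adj G i j} ij)
    B-on-edges : ∀ i j → B i j ≡ true → adj G i j ≡ true
    B-on-edges i j = ∧-trueˡ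
    B-covers : ∀ i j → adj G i j ≡ true → B i j ≡ true ⊎ B j i ≡ true
    B-covers i j ij with Finₚ.<-cmp i j
    ... | tri< i<j _ _ = inj₁ (∧-true ij (fromWitness≡ (i Fin.<? j) i<j))
    ... | tri≈ _ refl _ = ⊥-elim (true≢false (trans (sym ij) (irrfl G i)))
    ... | tri> _ _ j<i = inj₂ (∧-true (trans (adjSym G j i) ij) (fromWitness≡ (j Fin.<? i) j<i))
    B-one-way : ∀ i j → B i j ≡ true → B j i ≡ false
    B-one-way i j ij with B j i in ji
    ... | false = refl
    ... | true  = ⊥-elim (Finₚ.<-asym (B⇒< ij) (B⇒< ji))
    Walk⁺⇒< : ∀ {i j} → Walk⁺ B i j → i Fin.< j
    Walk⁺⇒< (arc ij)    = B⇒< ij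
    Walk⁺⇒< (step ij w) = Finₚ.<-trans (B⇒< ij) (Walk⁺⇒< w)
    B-acyclic : Acyclic B
    B-acyclic i = Finₚ.<-irrefl refl ∘ Walk⁺⇒<

allFunctions : ∀ {B : Set} → List B → (n : ℕ) → List (Fin n → B)
allFunctions xs zero    = []ᶠ ∷ []
allFunctions xs (suc n) = cartesianProductWith _∷ᶠ_ xs (allFunctions xs n)

allFunctions-complete : ∀ {B : Set} {xs : List B} (R : B → B → Set) →
  (∀ x → Σ B λ y → y ∈ xs × R x y) →
  ∀ n (f : Fin n → B) → Σ (Fin n → B) λ g → g ∈ allFunctions xs n × (∀ i → R (f i) (g i))
allFunctions-complete R complete zero    f = []ᶠ , here refl , λ ()
allFunctions-complete R complete (suc n) f
  with y , y∈ , Rf₀y ← complete (f zero)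
     | g , g∈ , Rfg  ← allFunctions-complete R complete n (f ∘ suc) =
  y ∷ᶠ g , ∈-cartesianProductWith⁺ _∷ᶠ_ y∈ g∈ , λ { zero → Rf₀y ; (suc i) → Rfg i }

allRel : ∀ n → List (Rel n)
allRel n = allFunctions (allFunctions (true ∷ false ∷ []) n) n

allRel-complete : ∀ {n} (A : Rel n) → Σ (Rel n) λ B → B ∈ allRel n × A ≗ᴿ B
allRel-complete {n} = allFunctions-complete (λ f g → ∀ j → f j ≡ g j)
  (allFunctions-complete _≡_ (λ { true → true , here refl , refl ; false → false , there (here refl) , refl }) n) n

dmin-exists : ∀ {n} (G : Graph n) → Σ ℕ (IsDmin G)
dmin-exists {n} G = numDependent best , (toAcyclicOrientation G {B = best} best-isAO , numDependent-correct best) , minimal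
  where
  candidates : List (Rel n)
  candidates = filter (IsAcyclicOrientation-dec G) (allRel n)
  best : Rel n
  best = argmin numDependent (arcs (proj₁ (indexOrder G))) candidates
  best-isAO : IsAcyclicOrientation G best
  best-isAO = argmin-all numDependent {P = IsAcyclicOrientation G} (isAcyclicOrientation G (indexOrder G))
                         (all-filter (IsAcyclicOrientation-dec G) (allRel n))
  minimal : ∀ (D : AcyclicOrientation G) k → NumDependent (arcs (proj₁ D)) k → numDependent best ≤ k
  minimal D k D-k = begin
    numDependent best ≤⟨ All.lookup (f[argmin]≤f[xs] {f = numDependent} (arcs (proj₁ (indexOrder G))) candidates) B-candidate ⟩
    numDependent B    ≡⟨ numDependent-unique (NumDependent-resp D≗B D-k) ⟩
    k                 ∎
    where
    open ℕ.≤-Reasoning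
    B : Rel n
    B = proj₁ (allRel-complete (arcs (proj₁ D)))
    D≗B : arcs (proj₁ D) ≗ᴿ B
    D≗B = proj₂ (proj₂ (allRel-complete (arcs (proj₁ D))))
    B-candidate : B ∈ candidates
    B-candidate = ∈-filter⁺ (IsAcyclicOrientation-dec G) (proj₁ (proj₂ (allRel-complete (arcs (proj₁ D)))))
                    (IsAcyclicOrientation-resp G D≗B (isAcyclicOrientation G D))

-- Adding a vertex

restrict : ∀ {n} → Rel (suc n) → Rel n
restrict A i j = A (suc i) (suc j)

module _ {n : ℕ} {A : Rel (suc n)} where

  Walk⁺-lift : ∀ {i j} → Walk⁺ (restrict A) i j → Walk⁺ A (suc i) (suc j)
  Walk⁺-lift (arc ij)    = arc ij
  Walk⁺-lift (step ij w) = step ij (Walk⁺-lift w)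

  Acyclic-restrict : Acyclic A → Acyclic (restrict A)
  Acyclic-restrict acyclic i = acyclic (suc i) ∘ Walk⁺-lift

  Dependent-lift : Acyclic A → ∀ {a b} → Dependent (restrict A) a b → Dependent A (suc a) (suc b)
  Dependent-lift acyclic d@(ab , _) with c , ac , c→b ← dependent⇒detour _ _ _ (Acyclic-restrict acyclic) d =
    detour⇒dependent A _ _ acyclic ab (suc c , ac , Walk⁺-lift c→b)

Shortcut₀ : ∀ {n} → Rel (suc n) → Set
Shortcut₀ A = ∀ x y → A (suc x) zero ≡ true → A zero (suc y) ≡ true → A (suc x) (suc y) ≡ true

module Shortcut {n : ℕ} {A : Rel (suc n)} (loopless : A zero zero ≡ false) (shortcut : Shortcut₀ A) where

  private
    no-loop : ∀ {P : Set} → A zero zero ≡ true → P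
    no-loop loop = ⊥-elim (true≢false (trans (sym loop) loopless))

  mutual
    Walk⁺-project : ∀ {i j} → Walk⁺ A (suc i) (suc j) → Walk⁺ (restrict A) i j
    Walk⁺-project (arc ij)                   = arc ij
    Walk⁺-project (step {j = suc m} im w)    = step im (Walk⁺-project w)
    Walk⁺-project (step {j = zero}  i0 w)    = Walk⁺-project-via₀ i0 w

    Walk⁺-project-via₀ : ∀ {i j} → A (suc i) zero ≡ true → Walk⁺ A zero (suc j) → Walk⁺ (restrict A) i j
    Walk⁺-project-via₀ i0 (arc 0j)                = arc (shortcut _ _ i0 0j)
    Walk⁺-project-via₀ i0 (step {j = suc m} 0m w) = step (shortcut _ _ i0 0m) (Walk⁺-project w)
    Walk⁺-project-via₀ i0 (step {j = zero}  loop w) = no-loop loop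

  walk-from₀ : ∀ {j} → Walk⁺ A zero (suc j) → Σ (Fin n) λ y → A zero (suc y) ≡ true × Walk* (restrict A) y j
  walk-from₀ (arc 0j)                = _ , 0j , inj₁ refl
  walk-from₀ (step {j = suc m} 0m w) = m , 0m , inj₂ (Walk⁺-project w)
  walk-from₀ (step {j = zero}  loop w) = no-loop loop

  walk-to₀ : ∀ {i} → Walk⁺ A (suc i) zero → Σ (Fin n) λ x → Walk* (restrict A) i x × A (suc x) zero ≡ true
  walk-to₀ (arc i0)                = _ , inj₁ refl , i0
  walk-to₀ (step {j = zero}  i0 w) = _ , inj₁ refl , i0
  walk-to₀ (step {j = suc m} im w) with x , m→x , x0 ← walk-to₀ w = x , inj₂ (arc im) *++* m→x , x0

  Acyclic-extend : Acyclic (restrict A) → Acyclic A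
  Acyclic-extend acyclic (suc i) cycle = acyclic i (Walk⁺-project cycle)
  Acyclic-extend acyclic zero (arc loop)  = no-loop loop
  Acyclic-extend acyclic zero (step {j = zero} loop w) = no-loop loop
  Acyclic-extend acyclic zero (step {j = suc y} 0y w) with x , y→x , x0 ← walk-to₀ w =
    acyclic x (arc (shortcut x y x0 0y) ⁺++* y→x)

  detour-project : ∀ {x y} → Detour A (suc x) (suc y) →
    Detour (restrict A) x y ⊎ (A (suc x) zero ≡ true × A zero (suc y) ≡ true)
  detour-project (suc c , xc , c→y) = inj₁ (c , xc , Walk⁺-project c→y)
  detour-project (zero , x0 , 0→y) with walk-from₀ 0→y
  ... | y′ , 0y′ , inj₁ refl  = inj₂ (x0 , 0y′)
  ... | y′ , 0y′ , inj₂ y′→y = inj₁ (y′ , shortcut _ _ x0 0y′ , y′→y)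

module Extension {n : ℕ} (G : Graph n) (Q : Subset n) (clique : IsClique G Q) where

  G′ : Graph (suc n)
  G′ = addVertex G Q

  adjacent-in-Q : ∀ {x y} → lookup Q x ≡ true → lookup Q y ≡ true → x ≢ y → adj G x y ≡ true
  adjacent-in-Q {x} {y} x∈Q y∈Q = clique x y (lookup⇒[]= x Q x∈Q) (lookup⇒[]= y Q y∈Q)

  NonTrivialArcIn : Rel n → Set
  NonTrivialArcIn A = Σ (Fin n) λ a → Σ (Fin n) λ b → a ∈ˢ Q × b ∈ˢ Q × NonTrivial A Q a b

  module Restriction (D′ : AcyclicOrientation G′) where

    A′ : Rel (suc n)
    A′ = arcs (proj₁ D′)

    A : Rel n
    A = restrict A′

    In Out depIn depOut slackIn slackOut : Fin n → Bool
    In      x = A′ (suc x) zero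
    Out     y = A′ zero (suc y)
    depIn   x = dependent? A′ (suc x) zero
    depOut  y = dependent? A′ zero (suc y)
    slackIn  x = In x ∧ not (depIn x)
    slackOut y = Out y ∧ not (depOut y)

    oldDep : Fin n → Fin n → Bool
    oldDep x y = dependent? A′ (suc x) (suc y)

    In⇒Q : ∀ {x} → In x ≡ true → lookup Q x ≡ true
    In⇒Q = on-edges (proj₁ D′) (suc _) zero

    Out⇒Q : ∀ {y} → Out y ≡ true → lookup Q y ≡ true
    Out⇒Q = on-edges (proj₁ D′) zero (suc _)

    shortcut : Shortcut₀ A′
    shortcut x y x0 0y with x ≟ y
    ... | yes refl = ⊥-elim (true≢false (trans (sym 0y) (one-way (proj₁ D′) (suc x) zero x0)))
    ... | no x≢y with covers (proj₁ D′) (suc x) (suc y) (adjacent-in-Q (In⇒Q x0) (Out⇒Q 0y) x≢y)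
    ...   | inj₁ xy = xy
    ...   | inj₂ yx = ⊥-elim (proj₂ D′ (suc x) (step x0 (step 0y (arc yx))))

    restriction : AcyclicOrientation G
    restriction =
      record { arcs     = A
             ; on-edges = λ i j → on-edges (proj₁ D′) (suc i) (suc j)
             ; covers   = λ i j → covers (proj₁ D′) (suc i) (suc j)
             ; one-way  = λ i j → one-way (proj₁ D′) (suc i) (suc j) }
      , Acyclic-restrict (proj₂ D′)

    slack⇒¬detour : ∀ {u v} → A′ u v ∧ not (dependent? A′ u v) ≡ true → ¬ Detour A′ u v
    slack⇒¬detour {u} {v} slack detour =
      toWitnessFalse≡ (Dependent-dec A′ u v) (not-true (∧-trueʳ {A′ u v} slack))
        (detour⇒dependent A′ u v (proj₂ D′) (∧-trueˡ slack) detour)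

    slackIn-unique : ∀ x y → slackIn x ≡ true → slackIn y ≡ true → x ≡ y
    slackIn-unique x y sx sy with x ≟ y
    ... | yes x≡y = x≡y
    ... | no x≢y with covers (proj₁ D′) (suc x) (suc y) (adjacent-in-Q (In⇒Q (∧-trueˡ sx)) (In⇒Q (∧-trueˡ sy)) x≢y)
    ...   | inj₁ xy = ⊥-elim (slack⇒¬detour sx (suc y , xy , arc (∧-trueˡ sy)))
    ...   | inj₂ yx = ⊥-elim (slack⇒¬detour sy (suc x , yx , arc (∧-trueˡ sx)))

    slackOut-unique : ∀ x y → slackOut x ≡ true → slackOut y ≡ true → x ≡ y
    slackOut-unique x y sx sy with x ≟ y
    ... | yes x≡y = x≡y
    ... | no x≢y with covers (proj₁ D′) (suc x) (suc y) (adjacent-in-Q (Out⇒Q (∧-trueˡ sx)) (Out⇒Q (∧-trueˡ sy)) x≢y)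
    ...   | inj₁ xy = ⊥-elim (slack⇒¬detour sy (suc x , ∧-trueˡ sx , arc xy))
    ...   | inj₂ yx = ⊥-elim (slack⇒¬detour sx (suc y , ∧-trueˡ sy , arc yx))

    numDependent-split : count depOut + (count depIn + count² oldDep) ≤ numDependent A′
    numDependent-split = begin
      count depOut + (count depIn + count² oldDep)
        ≡⟨ cong (count depOut +_) (count²-peel-column (dependent? A′ ∘ suc)) ⟨
      count depOut + count² (dependent? A′ ∘ suc)
        ≤⟨ ℕ.m≤n+m _ (bit (dependent? A′ zero zero)) ⟩
      bit (dependent? A′ zero zero) + (count depOut + count² (dependent? A′ ∘ suc))
        ≡⟨ ℕ.+-assoc (bit (dependent? A′ zero zero)) _ _ ⟨
      numDependent A′ ∎
      where open ℕ.≤-Reasoning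

    Q-covered : ∣ Q ∣ ≤ count In + count Out
    Q-covered = ℕ.≤-trans (ℕ.≤-reflexive (∣∣≡count-lookup Q))
                          (count-cover λ x → covers (proj₁ D′) (suc x) zero)

    -- All arcs between v and Q except the slack arcs are dependent, and so are the lifts of
    -- the dependent arcs of D.
    numDependent-restriction : ∀ k → numDependent A + k ≤ count² oldDep →
      k + (numDependent A + ∣ Q ∣) ≤ numDependent A′ + (count slackIn + count slackOut)
    numDependent-restriction k old = begin
      k + (numDependent A + ∣ Q ∣)
        ≡⟨ ℕ.+-assoc k (numDependent A) ∣ Q ∣ ⟨
      k + numDependent A + ∣ Q ∣
        ≤⟨ ℕ.+-mono-≤ (ℕ.≤-trans (ℕ.≤-reflexive (ℕ.+-comm k _)) old) Q-covered ⟩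
      count² oldDep + (count In + count Out)
        ≤⟨ ℕ.+-monoʳ-≤ (count² oldDep) (ℕ.+-mono-≤ (count-≤-+-slack In depIn) (count-≤-+-slack Out depOut)) ⟩
      count² oldDep + ((count depIn + count slackIn) + (count depOut + count slackOut))
        ≡⟨ rearrange (count² oldDep) (count depIn) (count slackIn) (count depOut) (count slackOut) ⟩
      count depOut + (count depIn + count² oldDep) + (count slackIn + count slackOut)
        ≤⟨ ℕ.+-monoˡ-≤ _ numDependent-split ⟩
      numDependent A′ + (count slackIn + count slackOut) ∎
      where
      open ℕ.≤-Reasoning
      rearrange : ∀ c i s o t → c + ((i + s) + (o + t)) ≡ o + (i + c) + (s + t)
      rearrange = solve-∀

    oldDep-lift : dependent? A ⊆² oldDep
    oldDep-lift x y d = fromWitness≡ (Dependent-dec A′ (suc x) (suc y))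
                          (Dependent-lift (proj₂ D′) (toWitness≡ (Dependent-dec A x y) d))

    slack≤2 : count slackIn + count slackOut ≤ 2
    slack≤2 = ℕ.+-mono-≤ (count-≤1 slackIn-unique) (count-≤1 slackOut-unique)

    numDependent-restriction₀ : numDependent A + ∣ Q ∣ ≤ numDependent A′ + (count slackIn + count slackOut)
    numDependent-restriction₀ =
      numDependent-restriction 0 (ℕ.≤-trans (ℕ.≤-reflexive (ℕ.+-identityʳ _)) (count²-mono oldDep-lift))

    restriction-lower-bound : numDependent A + ∣ Q ∣ ≤ numDependent A′ + 2
    restriction-lower-bound = ℕ.≤-trans numDependent-restriction₀ (ℕ.+-monoʳ-≤ _ slack≤2)

    at-most-one-slack : count slackIn + count slackOut ≤ 1 → numDependent A + ∣ Q ∣ < numDependent A′ + 2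
    at-most-one-slack slack≤1 =
      ℕ.≤-<-trans (ℕ.≤-trans numDependent-restriction₀ (ℕ.+-monoʳ-≤ _ slack≤1))
                  (ℕ.+-monoʳ-< (numDependent A′) (ℕ.n<1+n 1))

    slack⇒shortcut-dependent : ∀ {x y} → slackIn x ≡ true → slackOut y ≡ true → oldDep x y ≡ true
    slack⇒shortcut-dependent {x} {y} sx sy =
      fromWitness≡ (Dependent-dec A′ (suc x) (suc y))
        (detour⇒dependent A′ _ _ (proj₂ D′) (shortcut x y (∧-trueˡ sx) (∧-trueˡ sy)) (zero , ∧-trueˡ sx , arc (∧-trueˡ sy)))

    -- A detour inside Q would start with an arc x → z or end with a walk from z, and z is
    -- joined to v; either way one of the two slack arcs would get a detour.
    slack⇒nontrivial : ∀ {x y} → slackIn x ≡ true → slackOut y ≡ true → ¬ Dependent (induced A Q) x y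
    slack⇒nontrivial {x} {y} sx sy ind-dep
      with z , xz , z→y ← dependent⇒detour (induced A Q) x y (Acyclic-antimono (induced⊆ A Q) (proj₂ restriction)) ind-dep
         | covers (proj₁ D′) (suc z) zero (∧-trueʳ {lookup Q x} (∧-trueʳ {A x z} xz))
    ... | inj₁ z0 = slack⇒¬detour sx (suc z , ∧-trueˡ xz , arc z0)
    ... | inj₂ 0z = slack⇒¬detour sy (suc z , 0z , Walk⁺-lift (Walk⁺-mono (induced⊆ A Q) z→y))

    restriction-dichotomy : numDependent A + ∣ Q ∣ < numDependent A′ + 2 ⊎ NonTrivialArcIn A
    restriction-dichotomy with count-∅-or-witness slackIn | count-∅-or-witness slackOut
    ... | inj₁ none | _ =
      inj₁ (at-most-one-slack (ℕ.≤-trans (ℕ.≤-reflexive (cong (_+ count slackOut) none)) (count-≤1 slackOut-unique)))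
    ... | _ | inj₁ none =
      inj₁ (at-most-one-slack (ℕ.≤-trans (ℕ.≤-reflexive (trans (cong (count slackIn +_) none) (ℕ.+-identityʳ _)))
                                         (count-≤1 slackIn-unique)))
    ... | inj₂ (x , sx) | inj₂ (y , sy) with Dependent-dec A x y
    ...   | yes dep = inj₂ (x , y , lookup⇒[]= x Q (In⇒Q (∧-trueˡ sx)) , lookup⇒[]= y Q (Out⇒Q (∧-trueˡ sy))
                           , dep , slack⇒nontrivial sx sy)
    ...   | no ¬dep = inj₁ (ℕ.≤-trans (numDependent-restriction 1 extra) (ℕ.+-monoʳ-≤ _ slack≤2))
      where
      extra : numDependent A + 1 ≤ count² oldDep
      extra = ℕ.≤-trans (ℕ.≤-reflexive (ℕ.+-comm _ 1))
                (count²-mono-< oldDep-lift (slack⇒shortcut-dependent sx sy) (fromWitnessFalse≡ (Dependent-dec A x y) ¬dep))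

  module Insertion (D : AcyclicOrientation G) {a b : Fin n} (a∈Q : a ∈ˢ Q) (b∈Q : b ∈ˢ Q)
                   (nontrivial : NonTrivial (arcs (proj₁ D)) Q a b) where

    A : Rel n
    A = arcs (proj₁ D)

    ab : A a b ≡ true
    ab = proj₁ (proj₁ nontrivial)

    Qa : lookup Q a ≡ true
    Qa = []=⇒lookup a∈Q

    Qb : lookup Q b ≡ true
    Qb = []=⇒lookup b∈Q

    no-detour-in-Q : ∀ {y} → lookup Q y ≡ true → A a y ≡ true → A y b ≡ true → ⊥
    no-detour-in-Q {y} Qy ay yb =
      proj₂ nontrivial (detour⇒dependent (induced A Q) a b (Acyclic-antimono (induced⊆ A Q) (proj₂ D))
                          (∧-true ab (∧-true Qa Qb)) (y , ∧-true ay (∧-true Qa Qy) , arc (∧-true yb (∧-true Qy Qb))))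

    toNew : Fin n → Bool
    toNew x = ⌊ x ≟ a ⌋ ∨ A x a

    In Out : Fin n → Bool
    In  x = lookup Q x ∧ toNew x
    Out y = lookup Q y ∧ not (toNew y)

    toNew⇒ : ∀ {x} → toNew x ≡ true → x ≡ a ⊎ A x a ≡ true
    toNew⇒ {x} x→new with x ≟ a
    ... | yes x≡a = inj₁ x≡a
    ... | no  _   = inj₂ x→new

    toNew-a : toNew a ≡ true
    toNew-a with a ≟ a
    ... | yes _  = refl
    ... | no a≢a = ⊥-elim (a≢a refl)

    toNew-b : toNew b ≡ false
    toNew-b with b ≟ a
    ... | yes refl = ⊥-elim (proj₂ D a (arc ab))
    ... | no  _    = one-way (proj₁ D) a b ab

    toNew-in : ∀ {x} → A x a ≡ true → toNew x ≡ true
    toNew-in {x} xa = trans (cong (⌊ x ≟ a ⌋ ∨_) xa) (∨-zeroʳ ⌊ x ≟ a ⌋)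

    Out⇒¬toNew : ∀ {y} → Out y ≡ true → toNew y ≡ false
    Out⇒¬toNew {y} = not-true ∘ ∧-trueʳ {lookup Q y}

    Out⇒≢a : ∀ {y} → Out y ≡ true → y ≢ a
    Out⇒≢a Out-y refl = true≢false (trans (sym toNew-a) (Out⇒¬toNew Out-y))

    Out⇒from-a : ∀ {y} → Out y ≡ true → A a y ≡ true
    Out⇒from-a {y} Out-y with covers (proj₁ D) y a (adjacent-in-Q (∧-trueˡ Out-y) Qa (Out⇒≢a Out-y))
    ... | inj₁ ya = ⊥-elim (true≢false (trans (sym (toNew-in ya)) (Out⇒¬toNew Out-y)))
    ... | inj₂ ay = ay

    A″ : Rel (suc n)
    A″ zero    zero    = false
    A″ zero    (suc y) = Out y
    A″ (suc x) zero    = In x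
    A″ (suc x) (suc y) = A x y

    shortcut : Shortcut₀ A″
    shortcut x y In-x Out-y with toNew⇒ (∧-trueʳ {lookup Q x} In-x)
    ... | inj₁ refl = Out⇒from-a Out-y
    ... | inj₂ xa with x ≟ y
    ...   | yes refl = ⊥-elim (true≢false (trans (sym (∧-trueʳ {lookup Q x} In-x)) (Out⇒¬toNew Out-y)))
    ...   | no x≢y with covers (proj₁ D) x y (adjacent-in-Q (∧-trueˡ In-x) (∧-trueˡ Out-y) x≢y)
    ...     | inj₁ xy = xy
    ...     | inj₂ yx = ⊥-elim (proj₂ D y (step yx (step xa (arc (Out⇒from-a Out-y)))))

    open Shortcut {A = A″} refl shortcut

    extension : AcyclicOrientation G′
    extension = record { arcs = A″ ; on-edges = on-edges″ ; covers = covers″ ; one-way = one-way″ }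
              , Acyclic-extend (proj₂ D)
      where
      on-edges″ : ∀ i j → A″ i j ≡ true → adj G′ i j ≡ true
      on-edges″ zero    (suc y) = ∧-trueˡ
      on-edges″ (suc x) zero    = ∧-trueˡ
      on-edges″ (suc x) (suc y) = on-edges (proj₁ D) x y
      covers″ : ∀ i j → adj G′ i j ≡ true → A″ i j ≡ true ⊎ A″ j i ≡ true
      covers″ zero    (suc y) Qy with toNew y
      ... | true  = inj₂ (∧-true Qy refl)
      ... | false = inj₁ (∧-true Qy refl)
      covers″ (suc x) zero    Qx with toNew x
      ... | true  = inj₁ (∧-true Qx refl)
      ... | false = inj₂ (∧-true Qx refl)
      covers″ (suc x) (suc y) = covers (proj₁ D) x y
      one-way″ : ∀ i j → A″ i j ≡ true → A″ j i ≡ false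
      one-way″ zero    (suc y) Out-y rewrite Out⇒¬toNew Out-y = ∧-zeroʳ (lookup Q y)
      one-way″ (suc x) zero    In-x  rewrite ∧-trueʳ {lookup Q x} In-x = ∧-zeroʳ (lookup Q x)
      one-way″ (suc x) (suc y) = one-way (proj₁ D) x y

    shortcut-dependent : ∀ {x y} → In x ≡ true → Out y ≡ true → Dependent A x y
    shortcut-dependent {x} {y} In-x Out-y with toNew⇒ (∧-trueʳ {lookup Q x} In-x)
    ... | inj₂ xa = detour⇒dependent A x y (proj₂ D) (shortcut x y In-x Out-y) (a , xa , arc (Out⇒from-a Out-y))
    ... | inj₁ refl with y ≟ b
    ...   | yes refl = proj₁ nontrivial
    ...   | no y≢b with covers (proj₁ D) b y (adjacent-in-Q Qb (∧-trueˡ Out-y) (y≢b ∘ sym))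
    ...     | inj₁ by = detour⇒dependent A a y (proj₂ D) (Out⇒from-a Out-y) (b , ab , arc by)
    ...     | inj₂ yb = ⊥-elim (no-detour-in-Q (∧-trueˡ Out-y) (Out⇒from-a Out-y) yb)

    Dependent-project : ∀ {x y} → Dependent A″ (suc x) (suc y) → Dependent A x y
    Dependent-project {x} {y} dep with detour-project (dependent⇒detour A″ _ _ (proj₂ extension) dep)
    ... | inj₁ detour          = detour⇒dependent A x y (proj₂ D) (proj₁ dep) detour
    ... | inj₂ (In-x , Out-y) = shortcut-dependent In-x Out-y

    a↛new-independent : ¬ Dependent A″ (suc a) zero
    a↛new-independent dep with dependent⇒detour A″ _ _ (proj₂ extension) dep
    ... | zero  , _  , cycle = proj₂ extension zero cycle
    ... | suc c , ac , c→new with x , c→x , In-x ← walk-to₀ c→new | toNew⇒ (∧-trueʳ {lookup Q _} In-x)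
    ...   | inj₁ refl = proj₂ D a (arc ac ⁺++* c→x)
    ...   | inj₂ xa   = proj₂ D a (arc ac ⁺++⁺ (c→x *++⁺ arc xa))

    new↛b-independent : ¬ Dependent A″ zero (suc b)
    new↛b-independent dep with dependent⇒detour A″ _ _ (proj₂ extension) dep
    ... | zero , () , _
    ... | suc y , Out-y , y→b with Walk⁺-project y→b | y ≟ b
    ...   | y→b′ | yes refl = proj₂ D y y→b′
    ...   | y→b′ | no y≢b with covers (proj₁ D) y b (adjacent-in-Q (∧-trueˡ Out-y) Qb y≢b)
    ...     | inj₁ yb = no-detour-in-Q (∧-trueˡ Out-y) (Out⇒from-a Out-y) yb
    ...     | inj₂ by = proj₂ D y (y→b′ ⁺++⁺ arc by)

    depIn″ depOut″ : Fin n → Bool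
    depIn″  x = dependent? A″ (suc x) zero
    depOut″ y = dependent? A″ zero (suc y)

    oldDep″ : Fin n → Fin n → Bool
    oldDep″ x y = dependent? A″ (suc x) (suc y)

    numDependent-extension : numDependent A″ ≡ count depOut″ + (count depIn″ + count² oldDep″)
    numDependent-extension =
      cong₂ (λ t u → bit t + count depOut″ + u)
            (fromWitnessFalse≡ (Dependent-dec A″ zero zero) λ ())
            (count²-peel-column (dependent? A″ ∘ suc))

    dependent⇒arc : ∀ {u v} → dependent? A″ u v ≡ true → A″ u v ≡ true
    dependent⇒arc {u} {v} = proj₁ ∘ toWitness≡ (Dependent-dec A″ u v)

    depIn″⊆In : depIn″ ⊆ᵇ In
    depIn″⊆In x = dependent⇒arc {suc x} {zero}

    depOut″⊆Out : depOut″ ⊆ᵇ Out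
    depOut″⊆Out y = dependent⇒arc {zero} {suc y}

    extension-upper-bound : numDependent A″ + 2 ≤ numDependent A + ∣ Q ∣
    extension-upper-bound = begin
      numDependent A″ + 2
        ≡⟨ cong (_+ 2) numDependent-extension ⟩
      count depOut″ + (count depIn″ + count² oldDep″) + 2
        ≡⟨ shuffle (count depOut″) (count depIn″) (count² oldDep″) ⟩
      suc (count depOut″) + (suc (count depIn″) + count² oldDep″)
        ≤⟨ ℕ.+-mono-≤ (count-mono-< depOut″⊆Out (∧-true Qb (cong not toNew-b))
                                     (fromWitnessFalse≡ (Dependent-dec A″ zero (suc b)) new↛b-independent))
                      (ℕ.+-mono-≤ (count-mono-< depIn″⊆In (∧-true Qa toNew-a)
                                                 (fromWitnessFalse≡ (Dependent-dec A″ (suc a) zero) a↛new-independent))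
                                  (count²-mono λ x y → fromWitness≡ (Dependent-dec A x y) ∘ Dependent-project
                                                        ∘ toWitness≡ (Dependent-dec A″ (suc x) (suc y)))) ⟩
      count Out + (count In + numDependent A)
        ≡⟨ shuffle′ (count Out) (count In) (numDependent A) ⟩
      numDependent A + (count In + count Out)
        ≡⟨ cong (numDependent A +_) (trans (∣∣≡count-lookup Q) (count-split (lookup Q) toNew)) ⟨
      numDependent A + ∣ Q ∣ ∎
      where
      open ℕ.≤-Reasoning
      shuffle : ∀ o i c → o + (i + c) + 2 ≡ suc o + (suc i + c)
      shuffle = solve-∀
      shuffle′ : ∀ o i d → o + (i + d) ≡ d + (i + o)
      shuffle′ = solve-∀

  OptimalWithNonTrivialArc : ℕ → Set
  OptimalWithNonTrivialArc m = Σ (AcyclicOrientation G) λ D → NumDependent (arcs (proj₁ D)) m × NonTrivialArcIn (arcs (proj₁ D))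

  module _ {m m′ : ℕ} (dmin : IsDmin G m) (dmin′ : IsDmin G′ m′) where

    private
      open Restriction (proj₁ (proj₁ dmin′))

      A′≡m′ : numDependent A′ ≡ m′
      A′≡m′ = numDependent-unique (proj₂ (proj₁ dmin′))

      m≤A : m ≤ numDependent A
      m≤A = proj₂ dmin restriction (numDependent A) (numDependent-correct A)

      A+∣Q∣≤m′+2 : numDependent A + ∣ Q ∣ ≤ m′ + 2
      A+∣Q∣≤m′+2 = ℕ.≤-trans restriction-lower-bound (ℕ.≤-reflexive (cong (_+ 2) A′≡m′))

    dmin-lower-bound : m + ∣ Q ∣ ≤ m′ + 2
    dmin-lower-bound = ℕ.≤-trans (ℕ.+-monoˡ-≤ ∣ Q ∣ m≤A) A+∣Q∣≤m′+2

    nonTrivial⇒dmin-upper-bound : OptimalWithNonTrivialArc m → m′ + 2 ≤ m + ∣ Q ∣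
    nonTrivial⇒dmin-upper-bound (D , D-m , a , b , a∈Q , b∈Q , nontrivial) = begin
      m′ + 2                    ≤⟨ ℕ.+-monoˡ-≤ 2 (proj₂ dmin′ I.extension _ (numDependent-correct I.A″)) ⟩
      numDependent I.A″ + 2     ≤⟨ I.extension-upper-bound ⟩
      numDependent I.A + ∣ Q ∣  ≡⟨ cong (_+ ∣ Q ∣) (numDependent-unique D-m) ⟩
      m + ∣ Q ∣                 ∎
      where
      open ℕ.≤-Reasoning
      module I = Insertion D a∈Q b∈Q nontrivial

    dmin-tight⇒nonTrivial : m′ + 2 ≡ m + ∣ Q ∣ → OptimalWithNonTrivialArc m
    dmin-tight⇒nonTrivial tight with restriction-dichotomy
    ... | inj₁ A+∣Q∣<A′+2 = ⊥-elim (ℕ.<-irrefl refl (begin-strict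
      numDependent A + ∣ Q ∣ <⟨ A+∣Q∣<A′+2 ⟩
      numDependent A′ + 2    ≡⟨ cong (_+ 2) A′≡m′ ⟩
      m′ + 2                 ≡⟨ tight ⟩
      m + ∣ Q ∣              ≤⟨ ℕ.+-monoˡ-≤ ∣ Q ∣ m≤A ⟩
      numDependent A + ∣ Q ∣ ∎))
      where open ℕ.≤-Reasoning
    ... | inj₂ nonTrivialArc = restriction , subst (NumDependent A) A≡m (numDependent-correct A) , nonTrivialArc
      where
      A≡m : numDependent A ≡ m
      A≡m = ℕ.≤-antisym (ℕ.+-cancelʳ-≤ ∣ Q ∣ _ _ (ℕ.≤-trans A+∣Q∣≤m′+2 (ℕ.≤-reflexive tight))) m≤A

+≡⇒≡∸ : ∀ {m n k} → m + n ≡ k → m ≡ k ∸ n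
+≡⇒≡∸ {m} {n} refl = sym (ℕ.m+n∸n≡m m n)

≡∸⇒+≡ : ∀ {m n k} → n ≤ k → m ≡ k ∸ n → m + n ≡ k
≡∸⇒+≡ n≤k refl = ℕ.m∸n+n≡m n≤k

corollary6 : ∀ {n} (G : Graph n) (Q : Subset n) → IsClique G Q → 2 ≤ ∣ Q ∣ →
    Σ ℕ λ m → Σ ℕ λ m' → IsDmin G m × IsDmin (addVertex G Q) m' ×
    ((Σ (AcyclicOrientation G) λ D → NumDependent (arcs (proj₁ D)) m ×
    Σ (Fin n) λ a → Σ (Fin n) λ b → a ∈ˢ Q × b ∈ˢ Q × NonTrivial (arcs (proj₁ D)) Q a b)
    ⇔ (m' ≡ m + ∣ Q ∣ ∸ 2))
corollary6 G Q clique 2≤∣Q∣ =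
  m , m′ , dmin , dmin′ ,
  mk⇔ (λ optimal → +≡⇒≡∸ (ℕ.≤-antisym (nonTrivial⇒dmin-upper-bound dmin dmin′ optimal)
                                       (dmin-lower-bound dmin dmin′)))
      (dmin-tight⇒nonTrivial dmin dmin′ ∘ ≡∸⇒+≡ (ℕ.≤-trans 2≤∣Q∣ (ℕ.m≤n+m ∣ Q ∣ m)))
  where
  open Extension G Q clique
  m m′ : ℕ
  m  = proj₁ (dmin-exists G)
  m′ = proj₁ (dmin-exists G′)
  dmin : IsDmin G m
  dmin = proj₂ (dmin-exists G)
  dmin′ : IsDmin G′ m′
  dmin′ = proj₂ (dmin-exists G′)
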